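{- For every $k\ge1$ and $n\ge1$, $\mathcal{G}_n(M_k)=\{\pi\in\mathfrak{S}_n:\mathrm{cdes}(\pi^{ -1})\le k\}$. In particular, $\mathcal{G}_n(M_k)$ is closed under vertical rotations $\pi\mapsto c^j\pi$ and horizontal rotations $\pi\mapsto\pi c^j$, where $c=(1,2,\dots,n)$.
   Context: Geometric grid classes: for a matrix $M$ with entries in $\{0,1,-1\}$ with $r$ rows, divide a rectangle into unit cells indexed by the entries of $M$ (row $i$ from the top, column $j$ from the left); in each cell with entry $1$ draw the segment joining its lower-left and upper-right corners, and with entry $-1$ the segment joining its upper-left and lower-right corners. $\mathcal{G}_n(M)$ is the set of $\pi\in\mathfrak{S}_n$ obtained by placing $n$ points on these segments with no two sharing an $x$- or $y$-coordinate, labeling them $1,\dots,n$ by increasing $y$-coordinate and reading the labels by increasing $x$-coordinate. $M_k$ is the $2k\times2$ matrix whose odd-numbered rows (from the top) are $(1,0)$ and even-numbered rows are $(0,1)$. $\mathrm{Des}(\pi)=\{i\in[n-1]:\pi(i)>\pi(i+1)\}$; $\mathrm{cDes}(\pi)=\mathrm{Des}(\pi)$ if $\pi(n)<\pi(1)$ and $\mathrm{Des}(\pi)\cup\{n\}$ if $\pi(n)>\pi(1)$; $\mathrm{cdes}(\pi)=|\mathrm{cDes}(\pi)|$. Permutations multiply as functions: $(\pi\sigma)(i)=\pi(\sigma(i))$.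
   Formalization: The $n$ points placed on the segments in the definition of $\mathcal{G}_n(M_k)$ have rational coordinates. -}

module Defs where

open import Data.Bool using (Bool; true; false; if_then_else_)
open import Data.Nat as ℕ using (ℕ; zero; suc; _∸_)
open import Data.Nat.Properties using (_<?_)
open import Data.Fin using (Fin; toℕ; fromℕ<)
open import Data.Fin.Permutation using (Permutation′; _⟨$⟩ʳ_)
open import Data.Integer using (+_)
open import Data.Rational using (ℚ; _/_; _+_; _-_; _<_; _≤_; 0ℚ; 1ℚ)
open import Data.List using (List; length; filter; allFin)
open import Data.Product using (Σ; _×_; _,_)
open import Function.Bundles using (_⇔_)
open import Relation.Nullary using (¬_; Dec; yes; no)
open import Relation.Binary.PropositionalEquality using (_≡_)

data Entry : Set where
  zer one neg : Entry

-- An r × c matrix; (M i j) is the entry in row i (counted from the top,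
-- 0-based) and column j (counted from the left, 0-based).
Matrix : ℕ → ℕ → Set
Matrix r c = Fin r → Fin c → Entry

even : ℕ → Bool
even zero = true
even (suc n) = if even n then false else true

-- M_k : the 2k × 2 matrix whose odd-numbered rows (1-based, from the top)
-- are (1,0) and even-numbered rows are (0,1).  With 0-based row index i,
-- row i is (1,0) iff i is even.
Mk : (k : ℕ) → Matrix (2 ℕ.* k) 2
Mk k i j with even (toℕ i) | toℕ j
... | true  | zero  = one
... | true  | suc _ = zer
... | false | zero  = zer
... | false | suc _ = one

-- The cell (i , j) of an r-row matrix is the unit square
--   [ j , j+1 ] × [ r-1-i , r-i ]
-- (row i from the top, column j from the left).  A point on the segment
-- of that cell is given by a parameter t ∈ [0,1]:
--   entry  1 : (j + t , (r-1-i) + t)   (lower-left to upper-right)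
--   entry -1 : (j + t , (r-i)   - t)   (upper-left to lower-right)
-- Coordinates are rational (this gives the same class as
-- real coordinates).

ℕ→ℚ : ℕ → ℚ
ℕ→ℚ m = (+ m) / 1

xCoord : ∀ {c} → Fin c → ℚ → ℚ
xCoord j t = ℕ→ℚ (toℕ j) + t

yCoord : ∀ {r} → Fin r → Entry → ℚ → ℚ
yCoord {r} i one t = ℕ→ℚ (r ∸ suc (toℕ i)) + t
yCoord {r} i neg t = ℕ→ℚ (r ∸ toℕ i) - t
yCoord {r} i zer t = 0ℚ   -- never used: points lie only in nonzero cells

-- The points are indexed by a : Fin n in order of increasing x-coordinate;
-- distinct points have distinct x- and y-coordinates; labelling by
-- increasing y and reading by increasing x gives f, i.e. the label f a of
-- point a is order-isomorphic to its y-coordinate.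
record Placement {r c : ℕ} (M : Matrix r c) (n : ℕ) : Set where
  field
    row   : Fin n → Fin r
    col   : Fin n → Fin c
    param : Fin n → ℚ
    nonzeroCell : ∀ a → ¬ (M (row a) (col a) ≡ zer)
    param≥0     : ∀ a → 0ℚ ≤ param a
    param≤1     : ∀ a → param a ≤ 1ℚ

  x : Fin n → ℚ
  x a = xCoord (col a) (param a)

  y : Fin n → ℚ
  y a = yCoord (row a) (M (row a) (col a)) (param a)

open Placement public

InGrid : ∀ {r c n} → Matrix r c → (Fin n → Fin n) → Set
InGrid {r} {c} {n} M f =
  Σ (Placement M n) λ P →
    (∀ a b → toℕ a ℕ.< toℕ b → x P a < x P b)
    × (∀ a b → y P a ≡ y P b → a ≡ b)
    × (∀ a b → (y P a < y P b) ⇔ (toℕ (f a) ℕ.< toℕ (f b)))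

_∈𝒢_ : ∀ {n r c} → Permutation′ n → Matrix r c → Set
π ∈𝒢 M = InGrid M (π ⟨$⟩ʳ_)

-- the cyclic successor i ↦ i+1 (mod n) on Fin n, i.e. the cycle
-- c = (1,2,…,n) in 0-based notation
next : ∀ {n} → Fin n → Fin n
next {suc m} i with suc (toℕ i) <? suc m
... | yes p = fromℕ< p
... | no _  = Fin.zero
  where import Data.Fin as Fin

nextⁱ : ∀ {n} → ℕ → Fin n → Fin n
nextⁱ zero    i = i
nextⁱ (suc j) i = next (nextⁱ j i)

-- cDes(π) (0-based positions): position i < n-1 is in cDes iff
-- π(i) > π(i+1) (an ordinary descent); position n-1 (i.e. n in 1-based
-- notation) is in cDes iff π(n-1) > π(0), i.e. π(n) > π(1).
cDes : ∀ {n} → (Fin n → Fin n) → List (Fin n)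
cDes {n} π = filter (λ i → toℕ (π (next i)) <? toℕ (π i)) (allFin n)

cdes : ∀ {n} → (Fin n → Fin n) → ℕ
cdes π = length (cDes π)

{-# OPTIONS --safe #-}

-- In M_k every nonzero cell carries an increasing segment. Group the cells into levels 0, …, k:
-- level ℓ consists of the left cell whose top edge is at height 2ℓ and the right cell whose top
-- edge is at height 2ℓ + 1, so level 0 has only a right cell, level k only a left cell, and the
-- points of one level increase. Reading the points of a gridded π by increasing value, i.e.
-- reading π⁻¹, the level never drops and every descent of π⁻¹ raises it; a cyclic descent
-- (π⁻¹ ends to the right of where it starts) forbids starting on level 0 and ending on level k.
-- Hence cdes(π⁻¹) ≤ k. Conversely, if cdes(π⁻¹) ≤ k, put the point of value v on the level
-- counting the descents of π⁻¹ before v, in the left column iff it lies left of the point of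
-- smallest value, and order the points inside each cell by position. Both rotations preserve
-- cdes(π⁻¹), which gives the closure statement.

module Submission where

open import Defs
open import Data.Bool using (true; false)
open import Data.Nat using (ℕ; zero; suc; _+_; _*_; _∸_; _≤_; _<_; z≤n; s≤s; s≤s⁻¹; ⌊_/2⌋)
open import Data.Nat.Properties
import Data.Nat.Coprimality as Coprime
open import Data.Fin as Fin using (Fin; toℕ; fromℕ; fromℕ<; inject₁)
import Data.Fin.Properties as Finₚ
open import Data.Fin.Patterns using (0F; 1F)
open import Data.Fin.Permutation using (Permutation′; permutation; _⟨$⟩ʳ_; flip; inverseˡ; inverseʳ; _∘ₚ_)
open import Algebra.Properties.CommutativeMonoid.Sum +-0-commutativeMonoid
  using (sum-syntax; sum-cong-≗; sum-init-last; ∑-distrib-+; ∑-permute)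
open import Data.List using (filter; length; tabulate)
import Data.Integer as ℤ
import Data.Integer.Properties as ℤₚ
open import Data.Rational as ℚ using (ℚ; 0ℚ; 1ℚ; toℚᵘ)
import Data.Rational.Properties as ℚₚ
import Data.Rational.Unnormalised as ℚᵘ
import Data.Rational.Unnormalised.Properties as ℚᵘₚ
open import Data.Product using (Σ; _×_; _,_; proj₁; proj₂)
open import Data.Sum using (_⊎_; inj₁; inj₂)
open import Function using (_∘_; id)
open import Function.Bundles using (_⇔_; Equivalence; mk⇔)
open import Relation.Nullary using (¬_; Dec; yes; no)
open import Relation.Nullary.Negation using (contradiction)
open import Relation.Binary.Definitions using (tri<; tri≈; tri>)
open import Relation.Binary.PropositionalEquality
  using (_≡_; _≢_; refl; sym; trans; cong; cong₂; subst; subst₂; module ≡-Reasoning)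

private variable
  m n : ℕ

𝟙 : ∀ {p} {P : Set p} → Dec P → ℕ
𝟙 (yes _) = 1
𝟙 (no _)  = 0

𝟙-yes : ∀ {p} {P : Set p} (P? : Dec P) → P → 𝟙 P? ≡ 1
𝟙-yes (yes _) _ = refl
𝟙-yes (no ¬p) p = contradiction p ¬p

𝟙-no : ∀ {p} {P : Set p} (P? : Dec P) → ¬ P → 𝟙 P? ≡ 0
𝟙-no (yes p) ¬p = contradiction p ¬p
𝟙-no (no _)  _  = refl

𝟙-cong : ∀ {p q} {P : Set p} {Q : Set q} (P? : Dec P) (Q? : Dec Q) → (P → Q) → (Q → P) → 𝟙 P? ≡ 𝟙 Q?
𝟙-cong (yes _) (yes _) _ _ = refl
𝟙-cong (yes p) (no ¬q) f _ = contradiction (f p) ¬q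
𝟙-cong (no ¬p) (yes q) _ g = contradiction (g q) ¬p
𝟙-cong (no _)  (no _)  _ _ = refl

[_<_] : Fin n → Fin n → ℕ
[ a < b ] = 𝟙 (toℕ a <? toℕ b)

length-filter-tabulate : ∀ {a p} {A : Set a} {P : A → Set p} (P? : ∀ x → Dec (P x)) (f : Fin n → A) →
  length (filter P? (tabulate f)) ≡ ∑[ i < n ] 𝟙 (P? (f i))
length-filter-tabulate {zero}  P? f = refl
length-filter-tabulate {suc n} P? f with P? (f 0F)
... | yes _ = cong suc (length-filter-tabulate P? (f ∘ Fin.suc))
... | no _  = length-filter-tabulate P? (f ∘ Fin.suc)

∑-telescope-≤ : (d : Fin m → ℕ) (L : Fin (suc m) → ℕ) → (∀ i → d i + L (inject₁ i) ≤ L (Fin.suc i)) →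
  ∑[ i < m ] d i + L 0F ≤ L (fromℕ m)
∑-telescope-≤ {zero}  d L step = ≤-refl
∑-telescope-≤ {suc m} d L step = begin
  d 0F + ∑[ i < m ] d (Fin.suc i) + L 0F   ≡⟨ cong (_+ L 0F) (+-comm (d 0F) _) ⟩
  ∑[ i < m ] d (Fin.suc i) + d 0F + L 0F   ≡⟨ +-assoc (∑[ i < m ] d (Fin.suc i)) _ _ ⟩
  ∑[ i < m ] d (Fin.suc i) + (d 0F + L 0F) ≤⟨ +-monoʳ-≤ (∑[ i < m ] d (Fin.suc i)) (step 0F) ⟩
  ∑[ i < m ] d (Fin.suc i) + L 1F          ≤⟨ ∑-telescope-≤ (d ∘ Fin.suc) (L ∘ Fin.suc) (step ∘ Fin.suc) ⟩
  L (fromℕ (suc m))                        ∎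
  where open ≤-Reasoning

next-inject₁ : (i : Fin m) → next (inject₁ i) ≡ Fin.suc i
next-inject₁ {m} i with suc (toℕ (inject₁ i)) <? suc m
... | yes p = Finₚ.toℕ-injective (trans (Finₚ.toℕ-fromℕ< p) (cong suc (Finₚ.toℕ-inject₁ i)))
... | no ¬p = contradiction (s≤s (subst (_< m) (sym (Finₚ.toℕ-inject₁ i)) (Finₚ.toℕ<n i))) ¬p

next-fromℕ : ∀ m → next (fromℕ m) ≡ 0F
next-fromℕ m with suc (toℕ (fromℕ m)) <? suc m
... | yes p = contradiction (Finₚ.toℕ-fromℕ m) (<⇒≢ (s≤s⁻¹ p))
... | no _  = refl

prev : Fin n → Fin n
prev {suc m} 0F          = fromℕ m
prev {suc m} (Fin.suc i) = inject₁ i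

prevⁱ : ℕ → Fin n → Fin n
prevⁱ zero    i = i
prevⁱ (suc j) i = prevⁱ j (prev i)

next-prev : (i : Fin n) → next (prev i) ≡ i
next-prev {suc m} 0F          = next-fromℕ m
next-prev {suc m} (Fin.suc i) = next-inject₁ i

prev-next : (i : Fin n) → prev (next i) ≡ i
prev-next {suc m} i with suc (toℕ i) <? suc m
... | yes p = Finₚ.toℕ-injective (trans (Finₚ.toℕ-inject₁ _) (Finₚ.toℕ-fromℕ< (s≤s⁻¹ p)))
... | no ¬p = Finₚ.toℕ-injective
  (trans (Finₚ.toℕ-fromℕ m) (≤-antisym (≮⇒≥ (¬p ∘ s≤s)) (s≤s⁻¹ (Finₚ.toℕ<n i))))

rotation : ℕ → Permutation′ n
rotation j = permutation (nextⁱ j) (prevⁱ j) (next-prevⁱ j) (prev-nextⁱ j)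
  where
  next-prevⁱ : ∀ j i → nextⁱ j (prevⁱ j i) ≡ i
  next-prevⁱ zero    i = refl
  next-prevⁱ (suc j) i = trans (cong next (next-prevⁱ j (prev i))) (next-prev i)
  prev-nextⁱ : ∀ j i → prevⁱ j (nextⁱ j i) ≡ i
  prev-nextⁱ zero    i = refl
  prev-nextⁱ (suc j) i = trans (cong (prevⁱ j) (prev-next (nextⁱ j i))) (prev-nextⁱ j i)

∑-next : (f : Fin n → ℕ) → ∑[ i < n ] f i ≡ ∑[ i < n ] f (next i)
∑-next f = ∑-permute f (rotation 1)

descent : (Fin n → Fin n) → Fin n → ℕ
descent g i = [ g (next i) < g i ]

cdes≡∑descent : (g : Fin n → Fin n) → cdes g ≡ ∑[ i < n ] descent g i
cdes≡∑descent g = length-filter-tabulate (λ i → toℕ (g (next i)) <? toℕ (g i)) id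

cdes-init-last : (g : Fin (suc m) → Fin (suc m)) →
  cdes g ≡ ∑[ i < m ] [ g (Fin.suc i) < g (inject₁ i) ] + [ g 0F < g (fromℕ m) ]
cdes-init-last {m} g = begin
  cdes g                                                           ≡⟨ cdes≡∑descent g ⟩
  ∑[ i < suc m ] descent g i                                       ≡⟨ sum-init-last (descent g) ⟩
  ∑[ i < m ] descent g (inject₁ i) + descent g (fromℕ m)
    ≡⟨ cong₂ _+_ (sum-cong-≗ (λ i → cong (λ j → [ g j < g (inject₁ i) ]) (next-inject₁ i)))
                 (cong (λ j → [ g j < g (fromℕ m) ]) (next-fromℕ m)) ⟩
  ∑[ i < m ] [ g (Fin.suc i) < g (inject₁ i) ] + [ g 0F < g (fromℕ m) ] ∎
  where open ≡-Reasoning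

cdes-∘-prev : (g : Fin n → Fin n) → cdes (g ∘ prev) ≡ cdes g
cdes-∘-prev {n} g = begin
  cdes (g ∘ prev)                               ≡⟨ cdes≡∑descent (g ∘ prev) ⟩
  ∑[ i < n ] descent (g ∘ prev) i
    ≡⟨ sum-cong-≗ (λ i → cong (λ j → [ g j < g (prev i) ]) (prev-next i)) ⟩
  ∑[ i < n ] [ g i < g (prev i) ]               ≡⟨ ∑-next (λ i → [ g i < g (prev i) ]) ⟩
  ∑[ i < n ] [ g (next i) < g (prev (next i)) ]
    ≡⟨ sum-cong-≗ (λ i → cong (λ j → [ g (next i) < g j ]) (prev-next i)) ⟩
  ∑[ i < n ] descent g i                        ≡⟨ cdes≡∑descent g ⟨
  cdes g                                        ∎
  where open ≡-Reasoning

isZero : Fin n → ℕ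
isZero 0F          = 1
isZero (Fin.suc _) = 0

-- Shifting values down by one only changes the comparisons that involve the value 0.
[prev<prev]+isZero : (x y : Fin n) → [ prev y < prev x ] + isZero y ≡ [ y < x ] + isZero x
[prev<prev]+isZero {suc m} 0F 0F = cong (_+ 1) (𝟙-no (_ <? _) (<-irrefl refl))
[prev<prev]+isZero {suc m} 0F (Fin.suc y) = cong (_+ 0) (𝟙-yes (_ <? _)
  (subst₂ _<_ (sym (Finₚ.toℕ-inject₁ y)) (sym (Finₚ.toℕ-fromℕ m)) (Finₚ.toℕ<n y)))
[prev<prev]+isZero {suc m} (Fin.suc x) 0F = cong (_+ 1) (𝟙-no (_ <? _)
  (<-asym (subst₂ _<_ (sym (Finₚ.toℕ-inject₁ x)) (sym (Finₚ.toℕ-fromℕ m)) (Finₚ.toℕ<n x))))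
[prev<prev]+isZero {suc m} (Fin.suc x) (Fin.suc y) = cong (_+ 0) (𝟙-cong (_ <? _) (_ <? _)
  (λ lt → s≤s (subst₂ _<_ (Finₚ.toℕ-inject₁ y) (Finₚ.toℕ-inject₁ x) lt))
  (λ lt → subst₂ _<_ (sym (Finₚ.toℕ-inject₁ y)) (sym (Finₚ.toℕ-inject₁ x)) (s≤s⁻¹ lt)))

cdes-prev-∘ : (g : Fin n → Fin n) → cdes (prev ∘ g) ≡ cdes g
cdes-prev-∘ {n} g = begin
  cdes (prev ∘ g)                         ≡⟨ cdes≡∑descent (prev ∘ g) ⟩
  ∑[ i < n ] descent (prev ∘ g) i         ≡⟨ +-cancelʳ-≡ _ _ _ shifted ⟩
  ∑[ i < n ] descent g i                  ≡⟨ cdes≡∑descent g ⟨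
  cdes g                                  ∎
  where
  open ≡-Reasoning
  zeros : ℕ
  zeros = ∑[ i < n ] isZero (g i)
  shifted : ∑[ i < n ] descent (prev ∘ g) i + zeros ≡ ∑[ i < n ] descent g i + zeros
  shifted = begin
    ∑[ i < n ] descent (prev ∘ g) i + zeros
      ≡⟨ cong (∑[ i < n ] descent (prev ∘ g) i +_) (∑-next (isZero ∘ g)) ⟩
    ∑[ i < n ] descent (prev ∘ g) i + ∑[ i < n ] isZero (g (next i))
      ≡⟨ ∑-distrib-+ (descent (prev ∘ g)) (isZero ∘ g ∘ next) ⟨
    ∑[ i < n ] (descent (prev ∘ g) i + isZero (g (next i)))
      ≡⟨ sum-cong-≗ (λ i → [prev<prev]+isZero (g i) (g (next i))) ⟩
    ∑[ i < n ] (descent g i + isZero (g i))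
      ≡⟨ ∑-distrib-+ (descent g) (isZero ∘ g) ⟩
    ∑[ i < n ] descent g i + zeros ∎

cdes-∘-prevⁱ : ∀ j (g : Fin n → Fin n) → cdes (g ∘ prevⁱ j) ≡ cdes g
cdes-∘-prevⁱ zero    g = refl
cdes-∘-prevⁱ (suc j) g = trans (cdes-∘-prev (g ∘ prevⁱ j)) (cdes-∘-prevⁱ j g)

cdes-prevⁱ-∘ : ∀ j (g : Fin n → Fin n) → cdes (prevⁱ j ∘ g) ≡ cdes g
cdes-prevⁱ-∘ zero    g = refl
cdes-prevⁱ-∘ (suc j) g = trans (cdes-prevⁱ-∘ j (prev ∘ g)) (cdes-prev-∘ g)

-- The non-cyclic descents are bounded by the range of ℓ; the cyclic one is paid for by level 0
-- or level k being unused.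
cdes≤-of-levels : ∀ k (g : Fin (suc m) → Fin (suc m)) (ℓ : Fin (suc m) → ℕ) →
  (∀ i → ℓ (inject₁ i) ≤ ℓ (Fin.suc i)) →
  (∀ i → toℕ (g (Fin.suc i)) < toℕ (g (inject₁ i)) → ℓ (inject₁ i) < ℓ (Fin.suc i)) →
  ℓ (fromℕ m) ≤ k →
  (ℓ 0F ≡ 0 → toℕ (g 0F) < toℕ (g (fromℕ m)) → ℓ (fromℕ m) < k) →
  cdes g ≤ k
cdes≤-of-levels {m} k g ℓ mono strict ℓ≤k wrap =
  subst (_≤ k) (sym (cdes-init-last g)) (bound (toℕ (g 0F) <? toℕ (g (fromℕ m))))
  where
  D : ℕ
  D = ∑[ i < m ] [ g (Fin.suc i) < g (inject₁ i) ]
  step : ∀ i → [ g (Fin.suc i) < g (inject₁ i) ] + ℓ (inject₁ i) ≤ ℓ (Fin.suc i)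
  step i with toℕ (g (Fin.suc i)) <? toℕ (g (inject₁ i))
  ... | yes desc = strict i desc
  ... | no _     = mono i
  D+ℓ₀≤ℓₘ : D + ℓ 0F ≤ ℓ (fromℕ m)
  D+ℓ₀≤ℓₘ = ∑-telescope-≤ _ ℓ step
  bound : (w : Dec (toℕ (g 0F) < toℕ (g (fromℕ m)))) → D + 𝟙 w ≤ k
  bound (no _) = ≤-trans (+-monoʳ-≤ D z≤n) (≤-trans D+ℓ₀≤ℓₘ ℓ≤k)
  bound (yes w) with ℓ 0F in ℓ₀ | D+ℓ₀≤ℓₘ
  ... | zero  | D≤ℓₘ =
    subst (_≤ k) (+-comm 1 D) (≤-trans (s≤s (subst (_≤ _) (+-identityʳ D) D≤ℓₘ)) (wrap ℓ₀ w))
  ... | suc _ | D<ℓₘ = ≤-trans (+-monoʳ-≤ D (s≤s z≤n)) (≤-trans D<ℓₘ ℓ≤k)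

descentsBefore : (Fin (suc m) → ℕ) → Fin (suc m) → ℕ
descentsBefore         s 0F          = 0
descentsBefore {suc m} s (Fin.suc v) = 𝟙 (s 1F <? s 0F) + descentsBefore (s ∘ Fin.suc) v

descentsBefore-mono : (s : Fin (suc m) → ℕ) {v w : Fin (suc m)} → v Fin.≤ w → descentsBefore s v ≤ descentsBefore s w
descentsBefore-mono         s {0F}        _         = z≤n
descentsBefore-mono {suc m} s {Fin.suc v} {Fin.suc w} (s≤s v≤w) =
  +-monoʳ-≤ (𝟙 (s 1F <? s 0F)) (descentsBefore-mono (s ∘ Fin.suc) v≤w)

descentsBefore-flat : (s : Fin (suc m) → ℕ) {v w : Fin (suc m)} →
  descentsBefore s v ≡ descentsBefore s w → v Fin.≤ w → s v ≤ s w
descentsBefore-flat s {0F} {0F} _ _ = ≤-refl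
descentsBefore-flat {suc m} s {0F} {Fin.suc w} e _ with s (1F) <? s 0F
... | no s₁≮s₀ = ≤-trans (≮⇒≥ s₁≮s₀) (descentsBefore-flat (s ∘ Fin.suc) e z≤n)
descentsBefore-flat {suc m} s {Fin.suc v} {Fin.suc w} e (s≤s v≤w) =
  descentsBefore-flat (s ∘ Fin.suc) (+-cancelˡ-≡ (𝟙 (s 1F <? s 0F)) _ _ e) v≤w

descentsBefore-fromℕ : (s : Fin (suc m) → ℕ) →
  descentsBefore s (fromℕ m) ≡ ∑[ i < m ] 𝟙 (s (Fin.suc i) <? s (inject₁ i))
descentsBefore-fromℕ {zero}  s = refl
descentsBefore-fromℕ {suc m} s = cong (𝟙 (s 1F <? s 0F) +_) (descentsBefore-fromℕ (s ∘ Fin.suc))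

toℚᵘ-/ : ∀ a d → toℚᵘ ((ℤ.+ a) ℚ./ suc d) ℚᵘ.≃ ℚᵘ.mkℚᵘ (ℤ.+ a) d
toℚᵘ-/ a d = ℚₚ.toℚᵘ-fromℚᵘ (ℚᵘ.mkℚᵘ (ℤ.+ a) d)

/-<-cross : ∀ a d b e → a * suc e < b * suc d → (ℤ.+ a) ℚ./ suc d ℚ.< (ℤ.+ b) ℚ./ suc e
/-<-cross a d b e lt = ℚₚ.toℚᵘ-cancel-<
  (ℚᵘₚ.<-respˡ-≃ (ℚᵘₚ.≃-sym (toℚᵘ-/ a d)) (ℚᵘₚ.<-respʳ-≃ (ℚᵘₚ.≃-sym (toℚᵘ-/ b e))
    (ℚᵘ.*<* (subst₂ ℤ._<_ (ℤₚ.pos-* a (suc e)) (ℤₚ.pos-* b (suc d)) (ℤ.+<+ lt)))))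

/-≤-cross : ∀ a d b e → a * suc e ≤ b * suc d → (ℤ.+ a) ℚ./ suc d ℚ.≤ (ℤ.+ b) ℚ./ suc e
/-≤-cross a d b e le = ℚₚ.toℚᵘ-cancel-≤
  (ℚᵘₚ.≤-respˡ-≃ (ℚᵘₚ.≃-sym (toℚᵘ-/ a d)) (ℚᵘₚ.≤-respʳ-≃ (ℚᵘₚ.≃-sym (toℚᵘ-/ b e))
    (ℚᵘ.*≤* (subst₂ ℤ._≤_ (ℤₚ.pos-* a (suc e)) (ℤₚ.pos-* b (suc d)) (ℤ.+≤+ le)))))

ℕ→ℚ-mono-≤ : ∀ {a b} → a ≤ b → ℕ→ℚ a ℚ.≤ ℕ→ℚ b
ℕ→ℚ-mono-≤ {a} {b} a≤b = /-≤-cross a 0 b 0 (*-monoˡ-≤ 1 a≤b)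

ℕ→ℚ-suc : ∀ a → ℕ→ℚ a ℚ.+ 1ℚ ≡ ℕ→ℚ (suc a)
ℕ→ℚ-suc a = trans (cong (ℚ._+ 1ℚ) ℕ→ℚ≡mkℚ) (cong (ℚ._/ 1) numerator≡)
  where
  ℕ→ℚ≡mkℚ : ℕ→ℚ a ≡ ℚ.mkℚ (ℤ.+ a) 0 (Coprime.sym (Coprime.1-coprimeTo a))
  ℕ→ℚ≡mkℚ = ℚₚ.normalize-coprime (Coprime.sym (Coprime.1-coprimeTo a))
  numerator≡ : (ℤ.+ a) ℤ.* ℤ.1ℤ ℤ.+ ℤ.1ℤ ℤ.* ℤ.1ℤ ≡ ℤ.+ suc a
  numerator≡ = trans (cong (ℤ._+ ℤ.1ℤ) (ℤₚ.*-identityʳ (ℤ.+ a))) (cong ℤ.+_ (+-comm a 1))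

ℕ→ℚ-+1-≤ : ∀ {a b t} → a < b → 0ℚ ℚ.≤ t → ℕ→ℚ a ℚ.+ 1ℚ ℚ.≤ ℕ→ℚ b ℚ.+ t
ℕ→ℚ-+1-≤ {a} {b} {t} a<b 0≤t = begin
  ℕ→ℚ a ℚ.+ 1ℚ  ≡⟨ ℕ→ℚ-suc a ⟩
  ℕ→ℚ (suc a)   ≤⟨ ℕ→ℚ-mono-≤ a<b ⟩
  ℕ→ℚ b         ≡⟨ ℚₚ.+-identityʳ (ℕ→ℚ b) ⟨
  ℕ→ℚ b ℚ.+ 0ℚ  ≤⟨ ℚₚ.+-monoʳ-≤ (ℕ→ℚ b) 0≤t ⟩
  ℕ→ℚ b ℚ.+ t   ∎
  where open ℚₚ.≤-Reasoning

ℕ→ℚ-+-< : ∀ {a b s t} → a < b → s ℚ.< 1ℚ → 0ℚ ℚ.≤ t → ℕ→ℚ a ℚ.+ s ℚ.< ℕ→ℚ b ℚ.+ t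
ℕ→ℚ-+-< {a} a<b s<1 0≤t = ℚₚ.<-≤-trans (ℚₚ.+-monoʳ-< (ℕ→ℚ a) s<1) (ℕ→ℚ-+1-≤ a<b 0≤t)

ℕ→ℚ-+-≤ : ∀ {a b s t} → a < b → s ℚ.≤ 1ℚ → 0ℚ ℚ.≤ t → ℕ→ℚ a ℚ.+ s ℚ.≤ ℕ→ℚ b ℚ.+ t
ℕ→ℚ-+-≤ {a} a<b s≤1 0≤t = ℚₚ.≤-trans (ℚₚ.+-monoʳ-≤ (ℕ→ℚ a) s≤1) (ℕ→ℚ-+1-≤ a<b 0≤t)

ℕ→ℚ-+-<⇒≤ : ∀ {a b s t} → ℕ→ℚ a ℚ.+ s ℚ.< ℕ→ℚ b ℚ.+ t → 0ℚ ℚ.≤ s → t ℚ.≤ 1ℚ → a ≤ b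
ℕ→ℚ-+-<⇒≤ lt 0≤s t≤1 = ≮⇒≥ λ b<a → ℚₚ.<-irrefl refl (ℚₚ.<-≤-trans lt (ℕ→ℚ-+-≤ b<a t≤1 0≤s))

ℚ-+-cancelˡ-< : ∀ p {s t} → p ℚ.+ s ℚ.< p ℚ.+ t → s ℚ.< t
ℚ-+-cancelˡ-< p {s} {t} lt with ℚₚ.<-cmp s t
... | tri< s<t _ _ = s<t
... | tri≈ _ refl _ = contradiction lt (ℚₚ.<-irrefl refl)
... | tri> _ _ t<s = contradiction (ℚₚ.+-monoʳ-< p t<s) (ℚₚ.<-asym lt)

even-suc-suc : ∀ n → even (suc (suc n)) ≡ even n
even-suc-suc n with even n
... | true  = refl
... | false = refl

even-double+ : ∀ q n → even (q + q + n) ≡ even n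
even-double+ zero    n = refl
even-double+ (suc q) n = begin
  even (suc (q + suc q + n))   ≡⟨ cong (λ z → even (suc (z + n))) (+-suc q q) ⟩
  even (suc (suc (q + q + n))) ≡⟨ even-suc-suc (q + q + n) ⟩
  even (q + q + n)             ≡⟨ even-double+ q n ⟩
  even n                       ∎
  where open ≡-Reasoning

2*n≡n+n : ∀ n → 2 * n ≡ n + n
2*n≡n+n n = cong (n +_) (+-identityʳ n)

even-2* : ∀ k → even (2 * k) ≡ true
even-2* k = trans (cong even (trans (2*n≡n+n k) (sym (+-identityʳ (k + k))))) (even-double+ k 0)

even[m+n]⇒even-m≡even-n : ∀ m n → even (m + n) ≡ true → even m ≡ even n
even[m+n]⇒even-m≡even-n zero          n e = sym e
even[m+n]⇒even-m≡even-n (suc zero)    n e with even n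
... | false = refl
even[m+n]⇒even-m≡even-n (suc (suc m)) n e =
  trans (even-suc-suc m) (even[m+n]⇒even-m≡even-n m n (trans (sym (even-suc-suc (m + n))) e))

⌊n/2⌋-double+parity : ∀ n (j : Fin 2) → even n ≡ even (toℕ j) → ⌊ n /2⌋ + ⌊ n /2⌋ + toℕ j ≡ n
⌊n/2⌋-double+parity zero          0F _  = refl
⌊n/2⌋-double+parity zero          1F ()
⌊n/2⌋-double+parity (suc zero)    0F ()
⌊n/2⌋-double+parity (suc zero)    1F _  = refl
⌊n/2⌋-double+parity (suc (suc n)) j  e =
  cong suc (trans (cong (_+ toℕ j) (+-suc ⌊ n /2⌋ ⌊ n /2⌋))
                  (cong suc (⌊n/2⌋-double+parity n j (trans (sym (even-suc-suc n)) e))))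

Mk-nonzero⇒parity : ∀ k (i : Fin (2 * k)) (j : Fin 2) → Mk k i j ≢ zer → even (toℕ i) ≡ even (toℕ j)
Mk-nonzero⇒parity k i 0F nz with even (toℕ i)
... | true  = refl
... | false = contradiction refl nz
Mk-nonzero⇒parity k i 1F nz with even (toℕ i)
... | true  = contradiction refl nz
... | false = refl

Mk-parity⇒one : ∀ k (i : Fin (2 * k)) (j : Fin 2) → even (toℕ i) ≡ even (toℕ j) → Mk k i j ≡ one
Mk-parity⇒one k i 0F e with even (toℕ i)
... | true = refl
Mk-parity⇒one k i 1F e with even (toℕ i)
... | false = refl

bottom : ∀ {r} → Fin r → ℕ
bottom {r} i = r ∸ suc (toℕ i)

toℕ+suc-bottom : ∀ {r} (i : Fin r) → toℕ i + suc (bottom i) ≡ r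
toℕ+suc-bottom {r} i =
  trans (cong (toℕ i +_) (sym (+-∸-assoc 1 (Finₚ.toℕ<n i)))) (m+[n∸m]≡n (<⇒≤ (Finₚ.toℕ<n i)))

even-toℕ≡even-suc-bottom : ∀ k (i : Fin (2 * k)) → even (toℕ i) ≡ even (suc (bottom i))
even-toℕ≡even-suc-bottom k i = even[m+n]⇒even-m≡even-n (toℕ i) _ (trans (cong even (toℕ+suc-bottom i)) (even-2* k))

module MkPlacement (k : ℕ) {n} (P : Placement (Mk k) n) where

  column : Fin n → ℕ
  column a = toℕ (col P a)

  level : Fin n → ℕ
  level a = ⌊ suc (bottom (row P a)) /2⌋

  level-decomposition : ∀ a → level a + level a + column a ≡ suc (bottom (row P a))
  level-decomposition a = ⌊n/2⌋-double+parity _ (col P a)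
    (trans (sym (even-toℕ≡even-suc-bottom k (row P a))) (Mk-nonzero⇒parity k (row P a) (col P a) (nonzeroCell P a)))

  y≡ : ∀ a → y P a ≡ ℕ→ℚ (bottom (row P a)) ℚ.+ param P a
  y≡ a with Mk k (row P a) (col P a) | Mk-parity⇒one k (row P a) (col P a)
    (Mk-nonzero⇒parity k (row P a) (col P a) (nonzeroCell P a))
  ... | .one | refl = refl

  column≤1 : ∀ a → column a ≤ 1
  column≤1 a = s≤s⁻¹ (Finₚ.toℕ<n (col P a))

  suc-bottom≤2k : ∀ a → suc (bottom (row P a)) ≤ 2 * k
  suc-bottom≤2k a = subst (suc (bottom (row P a)) ≤_) (toℕ+suc-bottom (row P a)) (m≤n+m _ (toℕ (row P a)))

  level≤k : ∀ a → level a ≤ k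
  level≤k a = subst (level a ≤_) (trans (cong ⌊_/2⌋ (2*n≡n+n k)) (sym (n≡⌊n+n/2⌋ k)))
    (⌊n/2⌋-mono (suc-bottom≤2k a))

  level≡0⇒column≡1 : ∀ a → level a ≡ 0 → column a ≡ 1
  level≡0⇒column≡1 a ℓ≡0 = ≤-antisym (column≤1 a)
    (subst (1 ≤_) (trans (sym (level-decomposition a)) (cong (λ ℓ → ℓ + ℓ + column a) ℓ≡0)) (s≤s z≤n))

  level≡k⇒column≡0 : ∀ a → level a ≡ k → column a ≡ 0
  level≡k⇒column≡0 a ℓ≡k = n≤0⇒n≡0 (+-cancelˡ-≤ (k + k) (column a) 0 (begin
    k + k + column a             ≡⟨ cong (λ ℓ → ℓ + ℓ + column a) ℓ≡k ⟨
    level a + level a + column a ≡⟨ level-decomposition a ⟩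
    suc (bottom (row P a))       ≤⟨ suc-bottom≤2k a ⟩
    2 * k                        ≡⟨ 2*n≡n+n k ⟩
    k + k                        ≡⟨ +-identityʳ (k + k) ⟨
    k + k + 0                    ∎))
    where open ≤-Reasoning

  y<⇒bottom≤ : ∀ {a b} → y P a ℚ.< y P b → bottom (row P a) ≤ bottom (row P b)
  y<⇒bottom≤ {a} {b} lt = ℕ→ℚ-+-<⇒≤ (subst₂ ℚ._<_ (y≡ a) (y≡ b) lt) (param≥0 P a) (param≤1 P b)

  x<⇒column≤ : ∀ {a b} → x P a ℚ.< x P b → column a ≤ column b
  x<⇒column≤ {a} {b} lt = ℕ→ℚ-+-<⇒≤ lt (param≥0 P a) (param≤1 P b)

  y<⇒level≤ : ∀ {a b} → y P a ℚ.< y P b → level a ≤ level b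
  y<⇒level≤ lt = ⌊n/2⌋-mono (s≤s (y<⇒bottom≤ lt))

  -- Two points of one level in reversed x- and y-order would share a cell, whose segment increases.
  y<∧x>⇒level< : ∀ {a b} → y P a ℚ.< y P b → x P b ℚ.< x P a → level a < level b
  y<∧x>⇒level< {a} {b} y< x> = ≤∧≢⇒< (y<⇒level≤ y<) λ ℓa≡ℓb → ℚₚ.<-asym (param< ℓa≡ℓb) (param> ℓa≡ℓb)
    where
    column≡ : level a ≡ level b → column a ≡ column b
    column≡ ℓa≡ℓb = ≤-antisym (+-cancelˡ-≤ (level a + level a) _ _ (begin
      level a + level a + column a ≡⟨ level-decomposition a ⟩
      suc (bottom (row P a))       ≤⟨ s≤s (y<⇒bottom≤ y<) ⟩
      suc (bottom (row P b))       ≡⟨ level-decomposition b ⟨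
      level b + level b + column b ≡⟨ cong (λ ℓ → ℓ + ℓ + column b) ℓa≡ℓb ⟨
      level a + level a + column b ∎)) (x<⇒column≤ x>)
      where open ≤-Reasoning
    bottom≡ : level a ≡ level b → bottom (row P a) ≡ bottom (row P b)
    bottom≡ ℓa≡ℓb = suc-injective (trans (sym (level-decomposition a))
      (trans (cong₂ (λ ℓ c → ℓ + ℓ + c) ℓa≡ℓb (column≡ ℓa≡ℓb)) (level-decomposition b)))
    param< : level a ≡ level b → param P a ℚ.< param P b
    param< ℓa≡ℓb = ℚ-+-cancelˡ-< (ℕ→ℚ (bottom (row P a)))
      (subst₂ ℚ._<_ (y≡ a) (trans (y≡ b) (cong (λ z → ℕ→ℚ z ℚ.+ param P b) (sym (bottom≡ ℓa≡ℓb)))) y<)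
    param> : level a ≡ level b → param P b ℚ.< param P a
    param> ℓa≡ℓb = ℚ-+-cancelˡ-< (ℕ→ℚ (column b))
      (subst (λ c → ℕ→ℚ (column b) ℚ.+ param P b ℚ.< ℕ→ℚ c ℚ.+ param P a) (column≡ ℓa≡ℓb) x>)

  -- Level 0 lies in the right column only and level k in the left column only.
  x<∧level≡0⇒level<k : ∀ {a b} → x P a ℚ.< x P b → level a ≡ 0 → level b < k
  x<∧level≡0⇒level<k {a} {b} x< ℓa≡0 = ≤∧≢⇒< (level≤k b) λ ℓb≡k →
    0≢1+n (trans (sym (level≡k⇒column≡0 b ℓb≡k))
      (≤-antisym (column≤1 b) (subst (_≤ column b) (level≡0⇒column≡1 a ℓa≡0) (x<⇒column≤ x<))))

∈𝒢Mk⇒cdes≤ : ∀ k (π : Permutation′ n) → π ∈𝒢 Mk k → cdes (flip π ⟨$⟩ʳ_) ≤ k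
∈𝒢Mk⇒cdes≤ {zero}  k π _ = z≤n
∈𝒢Mk⇒cdes≤ {suc m} k π (P , x< , _ , y<⇔) =
  cdes≤-of-levels k g (level ∘ g)
    (λ i → y<⇒level≤ (value<⇒y< (Finₚ.≤̄⇒inject₁< ≤-refl)))
    (λ i desc → y<∧x>⇒level< (value<⇒y< (Finₚ.≤̄⇒inject₁< ≤-refl)) (x< _ _ desc))
    (level≤k (g (fromℕ m)))
    (λ ℓ₀≡0 wrap → x<∧level≡0⇒level<k (x< _ _ wrap) ℓ₀≡0)
  where
  open MkPlacement k P
  g : Fin (suc m) → Fin (suc m)
  g = flip π ⟨$⟩ʳ_
  value<⇒y< : ∀ {v w} → toℕ v < toℕ w → y P (g v) ℚ.< y P (g w)
  value<⇒y< {v} {w} v<w = Equivalence.from (y<⇔ (g v) (g w))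
    (subst₂ (λ v w → toℕ v < toℕ w) (sym (inverseʳ π)) (sym (inverseʳ π)) v<w)

<-mono⇒order-embedding : ∀ {a} {A : Set a} (f : A → ℕ) (Y : A → ℚ) →
  (∀ {a b} → f a ≡ f b → a ≡ b) → (∀ {a b} → f a < f b → Y a ℚ.< Y b) →
  (∀ a b → Y a ≡ Y b → a ≡ b) × (∀ a b → (Y a ℚ.< Y b) ⇔ (f a < f b))
<-mono⇒order-embedding f Y f-injective mono = Y-injective , λ a b → mk⇔ (reflects a b) mono
  where
  Y-injective : ∀ a b → Y a ≡ Y b → a ≡ b
  Y-injective a b Ya≡Yb with <-cmp (f a) (f b)
  ... | tri< fa<fb _ _ = contradiction Ya≡Yb (ℚₚ.<⇒≢ (mono fa<fb))
  ... | tri≈ _ fa≡fb _ = f-injective fa≡fb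
  ... | tri> _ _ fb<fa = contradiction (sym Ya≡Yb) (ℚₚ.<⇒≢ (mono fb<fa))
  reflects : ∀ a b → Y a ℚ.< Y b → f a < f b
  reflects a b Ya<Yb with <-cmp (f a) (f b)
  ... | tri< fa<fb _ _ = fa<fb
  ... | tri≈ _ fa≡fb _ = contradiction (cong Y (f-injective fa≡fb)) (ℚₚ.<⇒≢ Ya<Yb)
  ... | tri> _ _ fb<fa = contradiction (mono fb<fa) (ℚₚ.<-asym Ya<Yb)

rowWithTop : ∀ {r} h → 1 ≤ h → h ≤ r → Σ (Fin r) λ i → suc (bottom i) ≡ h
rowWithTop {r} h 1≤h h≤r = i , +-cancelˡ-≡ (toℕ i) _ _ (trans (toℕ+suc-bottom i) (sym toℕi+h≡r))
  where
  r∸h<r : r ∸ h < r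
  r∸h<r = ∸-monoʳ-< {o = 0} 1≤h h≤r
  i : Fin r
  i = fromℕ< r∸h<r
  toℕi+h≡r : toℕ i + h ≡ r
  toℕi+h≡r = trans (cong (_+ h) (Finₚ.toℕ-fromℕ< r∸h<r)) (m∸n+n≡m h≤r)

level<⇒height< : ∀ {ℓ ℓ′ c c′} → ℓ < ℓ′ → c ≤ 1 → ℓ + ℓ + c < ℓ′ + ℓ′ + c′
level<⇒height< {ℓ} {ℓ′} {c} {c′} ℓ<ℓ′ c≤1 = begin-strict
  ℓ + ℓ + c         ≤⟨ +-monoʳ-≤ (ℓ + ℓ) c≤1 ⟩
  ℓ + ℓ + 1         ≡⟨ +-comm (ℓ + ℓ) 1 ⟩
  suc (ℓ + ℓ)       <⟨ s≤s (≤-reflexive (sym (+-suc ℓ ℓ))) ⟩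
  suc ℓ + suc ℓ     ≤⟨ +-mono-≤ ℓ<ℓ′ ℓ<ℓ′ ⟩
  ℓ′ + ℓ′           ≤⟨ m≤m+n (ℓ′ + ℓ′) c′ ⟩
  ℓ′ + ℓ′ + c′      ∎
  where open ≤-Reasoning

module Construction (k : ℕ) (1≤k : 1 ≤ k) {m} (π : Permutation′ (suc m)) (cdes≤k : cdes (flip π ⟨$⟩ʳ_) ≤ k) where

  g : Fin (suc m) → Fin (suc m)
  g = flip π ⟨$⟩ʳ_

  levelOfValue : Fin (suc m) → ℕ
  levelOfValue = descentsBefore (toℕ ∘ g)

  level : Fin (suc m) → ℕ
  level a = levelOfValue (π ⟨$⟩ʳ a)

  levelOfValue-flat : ∀ {v w} → levelOfValue v ≡ levelOfValue w → v Fin.≤ w → toℕ (g v) ≤ toℕ (g w)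
  levelOfValue-flat = descentsBefore-flat (toℕ ∘ g)

  lastLevel+wrap≡cdes : levelOfValue (fromℕ m) + [ g 0F < g (fromℕ m) ] ≡ cdes g
  lastLevel+wrap≡cdes = trans (cong (_+ [ g 0F < g (fromℕ m) ]) (descentsBefore-fromℕ (toℕ ∘ g))) (sym (cdes-init-last g))

  lastLevel≤k : levelOfValue (fromℕ m) ≤ k
  lastLevel≤k = ≤-trans (m≤m+n _ _) (subst (_≤ k) (sym lastLevel+wrap≡cdes) cdes≤k)

  wrap⇒lastLevel<k : toℕ (g 0F) < toℕ (g (fromℕ m)) → levelOfValue (fromℕ m) < k
  wrap⇒lastLevel<k wrap = subst (_≤ k) (trans (cong (levelOfValue (fromℕ m) +_) (𝟙-yes _ wrap)) (+-comm _ 1))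
    (subst (_≤ k) (sym lastLevel+wrap≡cdes) cdes≤k)

  level≤lastLevel : ∀ a → level a ≤ levelOfValue (fromℕ m)
  level≤lastLevel a = descentsBefore-mono (toℕ ∘ g) (Finₚ.≤fromℕ (π ⟨$⟩ʳ a))

  toℕ∘g∘π : ∀ a → toℕ (g (π ⟨$⟩ʳ a)) ≡ toℕ a
  toℕ∘g∘π a = cong toℕ (inverseˡ π)

  left⇒1≤level : ∀ a → toℕ a < toℕ (g 0F) → 1 ≤ level a
  left⇒1≤level a a<g₀ = n≢0⇒n>0 λ ℓ≡0 →
    <⇒≱ a<g₀ (subst (toℕ (g 0F) ≤_) (toℕ∘g∘π a) (levelOfValue-flat (sym ℓ≡0) z≤n))

  right⇒level<k : ∀ a → toℕ (g 0F) ≤ toℕ a → level a < k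
  right⇒level<k a g₀≤a = ≤∧≢⇒< (≤-trans (level≤lastLevel a) lastLevel≤k) λ ℓ≡k → <⇒≢ 1≤k (begin-equality
    0                 ≡⟨ cong levelOfValue (inverseʳ π) ⟨
    level (g 0F)      ≡⟨ cong level (a≡g₀ ℓ≡k) ⟨
    level a           ≡⟨ ℓ≡k ⟩
    k                 ∎)
    where
    open ≤-Reasoning
    ℓ≡last : level a ≡ k → level a ≡ levelOfValue (fromℕ m)
    ℓ≡last ℓ≡k = ≤-antisym (level≤lastLevel a) (subst (levelOfValue (fromℕ m) ≤_) (sym ℓ≡k) lastLevel≤k)
    a≡g₀ : level a ≡ k → a ≡ g 0F
    a≡g₀ ℓ≡k = Finₚ.toℕ-injective (≤-antisym (begin
      toℕ a             ≡⟨ toℕ∘g∘π a ⟨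
      toℕ (g (π ⟨$⟩ʳ a)) ≤⟨ levelOfValue-flat (ℓ≡last ℓ≡k) (Finₚ.≤fromℕ (π ⟨$⟩ʳ a)) ⟩
      toℕ (g (fromℕ m)) ≤⟨ ≮⇒≥ (λ wrap → <⇒≢ (wrap⇒lastLevel<k wrap) (trans (sym (ℓ≡last ℓ≡k)) ℓ≡k)) ⟩
      toℕ (g 0F)        ∎) g₀≤a)

  column : Fin (suc m) → Fin 2
  column a with toℕ a <? toℕ (g 0F)
  ... | yes _ = 0F
  ... | no _  = 1F

  column-cases : ∀ a → (toℕ a < toℕ (g 0F) × toℕ (column a) ≡ 0) ⊎ (toℕ (g 0F) ≤ toℕ a × toℕ (column a) ≡ 1)
  column-cases a with toℕ a <? toℕ (g 0F)
  ... | yes a<g₀ = inj₁ (a<g₀ , refl)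
  ... | no  a≮g₀ = inj₂ (≮⇒≥ a≮g₀ , refl)

  column-mono : ∀ {a b} → toℕ a ≤ toℕ b → toℕ (column a) ≤ toℕ (column b)
  column-mono {a} {b} a≤b with column-cases a | column-cases b
  ... | inj₁ (_ , ca≡0) | _               = subst (_≤ _) (sym ca≡0) z≤n
  ... | inj₂ (_ , ca≡1) | inj₂ (_ , cb≡1) = ≤-reflexive (trans ca≡1 (sym cb≡1))
  ... | inj₂ (g₀≤a , _) | inj₁ (b<g₀ , _) = contradiction (≤-trans g₀≤a a≤b) (<⇒≱ b<g₀)

  height : Fin (suc m) → ℕ
  height a = level a + level a + toℕ (column a)

  1≤height : ∀ a → 1 ≤ height a
  1≤height a with column-cases a
  ... | inj₁ (a<g₀ , _) = ≤-trans (left⇒1≤level a a<g₀) (≤-trans (m≤m+n _ _) (m≤m+n _ _))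
  ... | inj₂ (_ , ca≡1) = subst (_≤ height a) ca≡1 (m≤n+m _ _)

  height≤2k : ∀ a → height a ≤ 2 * k
  height≤2k a with column-cases a
  ... | inj₁ (_ , ca≡0) = begin
    level a + level a + toℕ (column a) ≡⟨ cong (level a + level a +_) ca≡0 ⟩
    level a + level a + 0              ≡⟨ +-identityʳ _ ⟩
    level a + level a                  ≤⟨ +-mono-≤ ℓ≤k ℓ≤k ⟩
    k + k                              ≡⟨ 2*n≡n+n k ⟨
    2 * k                              ∎
    where
    open ≤-Reasoning
    ℓ≤k : level a ≤ k
    ℓ≤k = ≤-trans (level≤lastLevel a) lastLevel≤k
  ... | inj₂ (g₀≤a , ca≡1) = begin
    level a + level a + toℕ (column a) ≡⟨ cong (level a + level a +_) ca≡1 ⟩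
    level a + level a + 1              ≡⟨ +-assoc (level a) (level a) 1 ⟩
    level a + (level a + 1)            ≡⟨ cong (level a +_) (+-comm (level a) 1) ⟩
    level a + suc (level a)            ≤⟨ +-mono-≤ (<⇒≤ ℓ<k) ℓ<k ⟩
    k + k                              ≡⟨ 2*n≡n+n k ⟨
    2 * k                              ∎
    where
    open ≤-Reasoning
    ℓ<k : level a < k
    ℓ<k = right⇒level<k a g₀≤a

  row′ : Fin (suc m) → Fin (2 * k)
  row′ a = proj₁ (rowWithTop (height a) (1≤height a) (height≤2k a))

  suc-bottom≡height : ∀ a → suc (bottom (row′ a)) ≡ height a
  suc-bottom≡height a = proj₂ (rowWithTop (height a) (1≤height a) (height≤2k a))

  param′ : Fin (suc m) → ℚ
  param′ a = (ℤ.+ suc (toℕ a)) ℚ./ suc (suc m)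

  param′-mono : ∀ {a b} → toℕ a < toℕ b → param′ a ℚ.< param′ b
  param′-mono {a} {b} a<b = /-<-cross (suc (toℕ a)) (suc m) (suc (toℕ b)) (suc m) (*-monoˡ-< (suc (suc _)) (s≤s a<b))

  param′<1 : ∀ a → param′ a ℚ.< 1ℚ
  param′<1 a = /-<-cross (suc (toℕ a)) (suc m) 1 0
    (subst₂ _<_ (sym (*-identityʳ _)) (sym (+-identityʳ _)) (s≤s (Finₚ.toℕ<n a)))

  0≤param′ : ∀ a → 0ℚ ℚ.≤ param′ a
  0≤param′ a = /-≤-cross 0 0 (suc (toℕ a)) (suc m) z≤n

  Mk-one : ∀ a → Mk k (row′ a) (column a) ≡ one
  Mk-one a = Mk-parity⇒one k (row′ a) (column a) (begin
    even (toℕ (row′ a))                         ≡⟨ even-toℕ≡even-suc-bottom k (row′ a) ⟩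
    even (suc (bottom (row′ a)))                ≡⟨ cong even (suc-bottom≡height a) ⟩
    even (level a + level a + toℕ (column a))   ≡⟨ even-double+ (level a) _ ⟩
    even (toℕ (column a))                       ∎)
    where open ≡-Reasoning

  placement : Placement (Mk k) (suc m)
  placement = record
    { row         = row′
    ; col         = column
    ; param       = param′
    ; nonzeroCell = λ a a≡zer → case (trans (sym (Mk-one a)) a≡zer)
    ; param≥0     = 0≤param′
    ; param≤1     = λ a → ℚₚ.<⇒≤ (param′<1 a)
    }
    where
    case : one ≢ zer
    case ()

  π-injective : ∀ {a b} → toℕ (π ⟨$⟩ʳ a) ≡ toℕ (π ⟨$⟩ʳ b) → a ≡ b
  π-injective {a} {b} e = trans (sym (inverseˡ π)) (trans (cong g (Finₚ.toℕ-injective e)) (inverseˡ π))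

  sameLevel⇒position< : ∀ {a b} → toℕ (π ⟨$⟩ʳ a) < toℕ (π ⟨$⟩ʳ b) → level a ≡ level b → toℕ a < toℕ b
  sameLevel⇒position< {a} {b} v<w ℓa≡ℓb =
    ≤∧≢⇒< (subst₂ _≤_ (toℕ∘g∘π a) (toℕ∘g∘π b) (levelOfValue-flat ℓa≡ℓb (<⇒≤ v<w)))
          (λ a≡b → <⇒≢ v<w (cong (toℕ ∘ (π ⟨$⟩ʳ_)) (Finₚ.toℕ-injective a≡b)))

  _◁_ : Fin (suc m) → Fin (suc m) → Set
  a ◁ b = height a < height b ⊎ (height a ≡ height b × toℕ a < toℕ b)

  sameLevel⇒◁ : ∀ {a b} → toℕ a < toℕ b → level a ≡ level b → a ◁ b
  sameLevel⇒◁ {a} {b} a<b ℓa≡ℓb with m≤n⇒m<n∨m≡n height≤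
    where
    height≤ : height a ≤ height b
    height≤ = subst (λ ℓ → height a ≤ ℓ + ℓ + toℕ (column b)) ℓa≡ℓb
                (+-monoʳ-≤ (level a + level a) (column-mono (<⇒≤ a<b)))
  ... | inj₁ ha<hb = inj₁ ha<hb
  ... | inj₂ ha≡hb = inj₂ (ha≡hb , a<b)

  value<⇒◁ : ∀ {a b} → toℕ (π ⟨$⟩ʳ a) < toℕ (π ⟨$⟩ʳ b) → a ◁ b
  value<⇒◁ {a} {b} v<w with m≤n⇒m<n∨m≡n (descentsBefore-mono (toℕ ∘ g) (<⇒≤ v<w))
  ... | inj₁ ℓa<ℓb = inj₁ (level<⇒height< ℓa<ℓb (s≤s⁻¹ (Finₚ.toℕ<n (column a))))
  ... | inj₂ ℓa≡ℓb = sameLevel⇒◁ (sameLevel⇒position< v<w ℓa≡ℓb) ℓa≡ℓb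

  open MkPlacement k placement using (y≡)

  value<⇒y< : ∀ {a b} → toℕ (π ⟨$⟩ʳ a) < toℕ (π ⟨$⟩ʳ b) → y placement a ℚ.< y placement b
  value<⇒y< {a} {b} v<w = subst₂ ℚ._<_ (sym (y≡ a)) (sym (y≡ b)) (◁⇒y< (value<⇒◁ v<w))
    where
    ◁⇒y< : a ◁ b → ℕ→ℚ (bottom (row′ a)) ℚ.+ param′ a ℚ.< ℕ→ℚ (bottom (row′ b)) ℚ.+ param′ b
    ◁⇒y< (inj₁ ha<hb) = ℕ→ℚ-+-<
      (s≤s⁻¹ (subst₂ _<_ (sym (suc-bottom≡height a)) (sym (suc-bottom≡height b)) ha<hb)) (param′<1 a) (0≤param′ b)
    ◁⇒y< (inj₂ (ha≡hb , a<b)) = ℚₚ.+-mono-≤-<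
      (ℚₚ.≤-reflexive (cong ℕ→ℚ (suc-injective
        (trans (suc-bottom≡height a) (trans ha≡hb (sym (suc-bottom≡height b)))))))
      (param′-mono a<b)

  position<⇒x< : ∀ a b → toℕ a < toℕ b → x placement a ℚ.< x placement b
  position<⇒x< a b a<b = ℚₚ.+-mono-≤-< (ℕ→ℚ-mono-≤ (column-mono (<⇒≤ a<b))) (param′-mono a<b)

  π∈𝒢Mk : π ∈𝒢 Mk k
  π∈𝒢Mk = placement , position<⇒x<
        , <-mono⇒order-embedding (toℕ ∘ (π ⟨$⟩ʳ_)) (y placement) π-injective value<⇒y<

∈𝒢Mk⇔cdes≤ : ∀ k → 1 ≤ k → (π : Permutation′ (suc m)) → (π ∈𝒢 Mk k) ⇔ (cdes (flip π ⟨$⟩ʳ_) ≤ k)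
∈𝒢Mk⇔cdes≤ k 1≤k π = mk⇔ (∈𝒢Mk⇒cdes≤ k π) (Construction.π∈𝒢Mk k 1≤k π)

∘ₚrotation-∈𝒢Mk : ∀ k → 1 ≤ k → (π : Permutation′ (suc m)) (j : ℕ) →
  π ∈𝒢 Mk k → (π ∘ₚ rotation j) ∈𝒢 Mk k
∘ₚrotation-∈𝒢Mk k 1≤k π j π∈ = Construction.π∈𝒢Mk k 1≤k (π ∘ₚ rotation j)
  (subst (_≤ k) (sym (cdes-∘-prevⁱ j (flip π ⟨$⟩ʳ_))) (∈𝒢Mk⇒cdes≤ k π π∈))

rotation∘ₚ-∈𝒢Mk : ∀ k → 1 ≤ k → (π : Permutation′ (suc m)) (j : ℕ) →
  π ∈𝒢 Mk k → (rotation j ∘ₚ π) ∈𝒢 Mk k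
rotation∘ₚ-∈𝒢Mk k 1≤k π j π∈ = Construction.π∈𝒢Mk k 1≤k (rotation j ∘ₚ π)
  (subst (_≤ k) (sym (cdes-prevⁱ-∘ j (flip π ⟨$⟩ʳ_))) (∈𝒢Mk⇒cdes≤ k π π∈))

lemma6p5 : (k n : ℕ) → 1 ≤ k → 1 ≤ n →
    ((π : Permutation′ n) → (π ∈𝒢 Mk k) ⇔ (cdes (flip π ⟨$⟩ʳ_) ≤ k))
    × ((π : Permutation′ n) (j : ℕ) → π ∈𝒢 Mk k →
         InGrid (Mk k) (λ i → nextⁱ j (π ⟨$⟩ʳ i))
         × InGrid (Mk k) (λ i → π ⟨$⟩ʳ nextⁱ j i))
lemma6p5 k zero    1≤k ()
lemma6p5 k (suc m) 1≤k _ =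
  ∈𝒢Mk⇔cdes≤ k 1≤k ,
  λ π j π∈ → ∘ₚrotation-∈𝒢Mk k 1≤k π j π∈ , rotation∘ₚ-∈𝒢Mk k 1≤k π j π∈
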